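{- For integers $q,r\ge 2$, the grid graph $G=P_q\Box P_r$ satisfies $\kappa(G)=2q+2r-4$.
   Context: All graphs are finite, simple and connected; $d(u,v)$ is the shortest-path distance. $P_q\Box P_r$ is the Cartesian product of the paths on $q$ and $r$ vertices. For vertices $x,y,s$ put $\Delta_s(x,y)=|d(x,s)-d(y,s)|$ and for $S\subseteq V(G)$ put $\Delta_S(x,y)=\sum_{s\in S}\Delta_s(x,y)$. For an integer $k\ge1$, $S\subseteq V(G)$ is a weak $k$-resolving set if $\Delta_S(x,y)\ge k$ for every pair of distinct vertices $x,y$. $\kappa(G)$ is the largest $k$ such that $G$ has a weak $k$-resolving set. -}

module Defs where

open import Data.Nat using (ℕ; zero; suc; _+_; _≤_; ∣_-_∣)
open import Data.Fin using (Fin; toℕ)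
import Data.Fin as F
open import Data.Bool using (Bool; if_then_else_)
open import Data.Product using (_×_; _,_; proj₁; proj₂; Σ)
open import Data.Sum using (_⊎_)
open import Relation.Binary.PropositionalEquality using (_≡_; _≢_)

record Graph : Set₁ where
  field
    V   : Set
    Adj : V → V → Set
open Graph public

data Walk (G : Graph) : V G → V G → ℕ → Set where
  here : ∀ {u} → Walk G u u zero
  step : ∀ {u w v n} → Adj G u w → Walk G w v n → Walk G u v (suc n)

IsDistance : (G : Graph) → (V G → V G → ℕ) → Set
IsDistance G d =
  ∀ u v → Walk G u v (d u v) × (∀ n → Walk G u v n → d u v ≤ n)

Grid : ℕ → ℕ → Graph
Grid q r = record
  { V   = Fin q × Fin r
  ; Adj = λ x y →
      (proj₁ x ≡ proj₁ y × ∣ toℕ (proj₂ x) - toℕ (proj₂ y) ∣ ≡ 1)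
      ⊎ (proj₂ x ≡ proj₂ y × ∣ toℕ (proj₁ x) - toℕ (proj₁ y) ∣ ≡ 1)
  }

sumFin : ∀ {n} → (Fin n → ℕ) → ℕ
sumFin {zero}  f = 0
sumFin {suc n} f = f F.zero + sumFin (λ i → f (F.suc i))

GridSubset : ℕ → ℕ → Set
GridSubset q r = Fin q → Fin r → Bool

ΔS : ∀ {q r} → (d : Fin q × Fin r → Fin q × Fin r → ℕ) →
     GridSubset q r → Fin q × Fin r → Fin q × Fin r → ℕ
ΔS d S x y = sumFin (λ i → sumFin (λ j →
  if S i j then ∣ d x (i , j) - d y (i , j) ∣ else 0))

WeakResolving : ∀ {q r} → (d : Fin q × Fin r → Fin q × Fin r → ℕ) →
                ℕ → GridSubset q r → Set
WeakResolving d k S = ∀ x y → x ≢ y → k ≤ ΔS d S x y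

KappaIs : ∀ {q r} → (d : Fin q × Fin r → Fin q × Fin r → ℕ) → ℕ → Set
KappaIs {q} {r} d m =
  1 ≤ m × Σ (GridSubset q r) (WeakResolving d m)
  × (∀ k (S : GridSubset q r) → 1 ≤ k → WeakResolving d k S → k ≤ m)

{-# OPTIONS --safe #-}
module Submission where

-- The distance in the grid is the Manhattan distance, and Δ_S grows with S, so
-- κ(G) is the least value of Δ_V(x,y) over distinct x, y.  The two neighbours
-- (1,0) and (0,1) of a corner are separated, by 2 each, only at the other
-- q + r − 2 vertices of the first row and the first column.  Conversely, if x
-- and y differ in both coordinates, the two ends of every column and the two
-- ends of every inner row together separate them by at least 2, which gives
-- 2r + 2(q − 2); if they agree in one coordinate, then along each line in the
-- other direction consecutive vertices separate them by at least 2 in total,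
-- so every such line contributes at least its length and Δ_V(x,y) ≥ qr.

open import Defs
open import Data.Bool using (true; false; if_then_else_)
open import Data.Empty using (⊥-elim)
open import Data.Fin using (Fin; toℕ) renaming (zero to fzero; suc to fsuc)
open import Data.Fin.Properties using (toℕ-injective; toℕ<n)
open import Data.Nat using (ℕ; zero; suc; _+_; _*_; _∸_; _≤_; _<_; z≤n; s≤s; ∣_-_∣; _≟_)
open import Data.Nat.Properties
open import Algebra.Properties.CommutativeSemigroup +-commutativeSemigroup
  using (interchange)
open import Data.Nat.Tactic.RingSolver using (solve-∀)
open import Data.Product using (_×_; _,_; proj₁; proj₂)
open import Data.Sum using (inj₁; inj₂)
open import Function using (id; _∘_)
open import Relation.Binary.PropositionalEquality
open import Relation.Nullary using (yes; no)

sumTo : ℕ → (ℕ → ℕ) → ℕ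
sumTo zero    f = 0
sumTo (suc n) f = f 0 + sumTo n (f ∘ suc)

sumTo-cong : ∀ n {f g : ℕ → ℕ} → (∀ k → f k ≡ g k) → sumTo n f ≡ sumTo n g
sumTo-cong zero    f≗g = refl
sumTo-cong (suc n) f≗g = cong₂ _+_ (f≗g 0) (sumTo-cong n (f≗g ∘ suc))

sumTo-mono-≤ : ∀ n {f g : ℕ → ℕ} → (∀ k → f k ≤ g k) → sumTo n f ≤ sumTo n g
sumTo-mono-≤ zero    f≤g = z≤n
sumTo-mono-≤ (suc n) f≤g = +-mono-≤ (f≤g 0) (sumTo-mono-≤ n (f≤g ∘ suc))

sumTo-const : ∀ n c → sumTo n (λ _ → c) ≡ n * c
sumTo-const zero    c = refl
sumTo-const (suc n) c = cong (c +_) (sumTo-const n c)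

n*c≤sumTo : ∀ n {c} {f : ℕ → ℕ} → (∀ k → c ≤ f k) → n * c ≤ sumTo n f
n*c≤sumTo n {c} c≤f = subst (_≤ _) (sumTo-const n c) (sumTo-mono-≤ n c≤f)

sumTo-+ : ∀ n (f g : ℕ → ℕ) → sumTo n (λ k → f k + g k) ≡ sumTo n f + sumTo n g
sumTo-+ zero    f g = refl
sumTo-+ (suc n) f g = trans (cong (f 0 + g 0 +_) (sumTo-+ n (f ∘ suc) (g ∘ suc)))
                            (interchange (f 0) (g 0) _ _)

sumTo-* : ∀ n m (f : ℕ → ℕ) → sumTo n (λ k → m * f k) ≡ m * sumTo n f
sumTo-* zero    m f = sym (*-zeroʳ m)
sumTo-* (suc n) m f = trans (cong (m * f 0 +_) (sumTo-* n m (f ∘ suc)))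
                            (sym (*-distribˡ-+ m (f 0) _))

sumTo-snoc : ∀ n (f : ℕ → ℕ) → sumTo (suc n) f ≡ sumTo n f + f n
sumTo-snoc zero    f = +-comm (f 0) 0
sumTo-snoc (suc n) f = trans (cong (f 0 +_) (sumTo-snoc n (f ∘ suc))) (sym (+-assoc (f 0) _ _))

sumTo-firstLast : ∀ n (f : ℕ → ℕ) → sumTo (2 + n) f ≡ (f 0 + f (suc n)) + sumTo n (f ∘ suc)
sumTo-firstLast n f = trans (cong (f 0 +_) (sumTo-snoc n (f ∘ suc))) (reorder (f 0) _ _)
  where
  reorder : ∀ x y z → x + (y + z) ≡ (x + z) + y
  reorder = solve-∀

firstLast≤sumTo : ∀ n (f : ℕ → ℕ) → f 0 + f (suc n) ≤ sumTo (2 + n) f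
firstLast≤sumTo n f = ≤-trans (m≤m+n _ _) (≤-reflexive (sym (sumTo-firstLast n f)))

pairs≥2⇒suc-n≤sumTo : ∀ n {f : ℕ → ℕ} → (∀ k → 2 ≤ f k + f (suc k)) → 1 ≤ f n →
                      suc n ≤ sumTo (suc n) f
pairs≥2⇒suc-n≤sumTo zero          {f} _     1≤fn = ≤-trans 1≤fn (m≤m+n (f 0) 0)
pairs≥2⇒suc-n≤sumTo (suc zero)    {f} pairs _    =
  subst (2 ≤_) (cong (f 0 +_) (sym (+-identityʳ (f 1)))) (pairs 0)
pairs≥2⇒suc-n≤sumTo (suc (suc n)) {f} pairs 1≤fn =
  subst (3 + n ≤_) (+-assoc (f 0) (f 1) _)
    (+-mono-≤ (pairs 0) (pairs≥2⇒suc-n≤sumTo n {f ∘ suc ∘ suc} (pairs ∘ suc ∘ suc) 1≤fn))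

sumFin≡sumTo : ∀ n {g : Fin n → ℕ} {f : ℕ → ℕ} → (∀ i → g i ≡ f (toℕ i)) →
               sumFin g ≡ sumTo n f
sumFin≡sumTo zero    g≗f = refl
sumFin≡sumTo (suc n) g≗f = cong₂ _+_ (g≗f fzero) (sumFin≡sumTo n (g≗f ∘ fsuc))

sumFin-mono-≤ : ∀ n {f g : Fin n → ℕ} → (∀ i → f i ≤ g i) → sumFin f ≤ sumFin g
sumFin-mono-≤ zero    f≤g = z≤n
sumFin-mono-≤ (suc n) f≤g = +-mono-≤ (f≤g fzero) (sumFin-mono-≤ n (f≤g ∘ fsuc))

∣m+n-n∣≡m : ∀ m n → ∣ m + n - n ∣ ≡ m
∣m+n-n∣≡m m n = trans (∣-∣-comm (m + n) n)
  (trans (cong (λ k → ∣ n - k ∣) (+-comm m n)) (∣m-m+n∣≡n n m))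

∣m+o-n+o∣≡∣m-n∣ : ∀ m n o → ∣ m + o - n + o ∣ ≡ ∣ m - n ∣
∣m+o-n+o∣≡∣m-n∣ m n o = trans (cong₂ ∣_-_∣ (+-comm m o) (+-comm n o)) (∣m+n-m+o∣≡∣n-o∣ o m n)

∣2+n-n∣≡2 : ∀ n → ∣ 2 + n - n ∣ ≡ 2
∣2+n-n∣≡2 zero    = refl
∣2+n-n∣≡2 (suc n) = ∣2+n-n∣≡2 n

m≢n⇒1≤∣m-n∣ : ∀ {m n} → m ≢ n → 1 ≤ ∣ m - n ∣
m≢n⇒1≤∣m-n∣ m≢n = n≢0⇒n>0 (m≢n ∘ ∣m-n∣≡0⇒m≡n)

∣m-n∣≡1⇒∣m-o∣≤1+∣n-o∣ : ∀ m n o → ∣ m - n ∣ ≡ 1 → ∣ m - o ∣ ≤ suc ∣ n - o ∣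
∣m-n∣≡1⇒∣m-o∣≤1+∣n-o∣ m n o m~n =
  subst (λ k → ∣ m - o ∣ ≤ k + ∣ n - o ∣) m~n (∣-∣-triangle m n o)

∣x+w-y+z∣≤∣x-y∣+∣z-w∣ : ∀ x y z w → ∣ x + w - y + z ∣ ≤ ∣ x - y ∣ + ∣ z - w ∣
∣x+w-y+z∣≤∣x-y∣+∣z-w∣ x y z w = begin
  ∣ x + w - y + z ∣                     ≤⟨ ∣-∣-triangle (x + w) (y + w) (y + z) ⟩
  ∣ x + w - y + w ∣ + ∣ y + w - y + z ∣ ≡⟨ cong₂ _+_ (∣m+o-n+o∣≡∣m-n∣ x y w) (∣m+n-m+o∣≡∣n-o∣ y w z) ⟩
  ∣ x - y ∣ + ∣ w - z ∣                 ≡⟨ cong (∣ x - y ∣ +_) (∣-∣-comm w z) ⟩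
  ∣ x - y ∣ + ∣ z - w ∣                 ∎
  where open ≤-Reasoning

2≤∣m-1+n∣+∣1+m-n∣ : ∀ m n → 2 ≤ ∣ m - suc n ∣ + ∣ suc m - n ∣
2≤∣m-1+n∣+∣1+m-n∣ zero    zero    = ≤-refl
2≤∣m-1+n∣+∣1+m-n∣ zero    (suc n) = m≤m+n 2 _
2≤∣m-1+n∣+∣1+m-n∣ (suc m) zero    = ≤-trans (m≤m+n 2 m) (m≤n+m (2 + m) _)
2≤∣m-1+n∣+∣1+m-n∣ (suc m) (suc n) = 2≤∣m-1+n∣+∣1+m-n∣ m n

distGap : ℕ → ℕ → ℕ → ℕ
distGap a c i = ∣ ∣ a - i ∣ - ∣ c - i ∣ ∣

-- m + j is the distance from j to a point m steps to the left of 0; this is the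
-- case a = 0 of distGap-adjacent, generalised so that the induction goes through.
shifted-distGap-adjacent : ∀ m e j → 1 ≤ m + e →
  2 ≤ ∣ m + j - ∣ e - j ∣ ∣ + ∣ m + suc j - ∣ e - suc j ∣ ∣
shifted-distGap-adjacent m zero j 1≤m+0 =
  subst (2 ≤_) (sym (cong₂ _+_ (∣m+n-n∣≡m m j) (∣m+n-n∣≡m m (suc j))))
    (+-mono-≤ 1≤m 1≤m)
  where
  1≤m : 1 ≤ m
  1≤m = subst (1 ≤_) (+-identityʳ m) 1≤m+0
shifted-distGap-adjacent m (suc e) zero _
  rewrite +-identityʳ m | +-comm m 1 | ∣-∣-identityʳ e = 2≤∣m-1+n∣+∣1+m-n∣ m e
shifted-distGap-adjacent m (suc e) (suc j) _
  rewrite +-suc m j | +-suc m (suc j) = shifted-distGap-adjacent (suc m) e j (s≤s z≤n)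

distGap-adjacent : ∀ {a c} i → a ≢ c → 2 ≤ distGap a c i + distGap a c (suc i)
distGap-adjacent {zero}  {zero}  i       a≢c = ⊥-elim (a≢c refl)
distGap-adjacent {zero}  {suc c} i       _   = shifted-distGap-adjacent 0 (suc c) i (s≤s z≤n)
distGap-adjacent {suc a} {zero}  i       _   =
  subst (2 ≤_) (cong₂ _+_ (∣-∣-comm i ∣ suc a - i ∣) (∣-∣-comm (suc i) ∣ suc a - suc i ∣))
    (shifted-distGap-adjacent 0 (suc a) i (s≤s z≤n))
distGap-adjacent {suc a} {suc c} zero    a≢c
  rewrite ∣-∣-identityʳ a | ∣-∣-identityʳ c = +-mono-≤ 1≤∣a-c∣ 1≤∣a-c∣
  where
  1≤∣a-c∣ : 1 ≤ ∣ a - c ∣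
  1≤∣a-c∣ = m≢n⇒1≤∣m-n∣ (a≢c ∘ cong suc)
distGap-adjacent {suc a} {suc c} (suc i) a≢c = distGap-adjacent i (a≢c ∘ cong suc)

distGap-last : ∀ {a c n} → a ≤ n → c ≤ n → a ≢ c → 1 ≤ distGap a c n
distGap-last a≤n c≤n a≢c rewrite m≤n⇒∣m-n∣≡n∸m a≤n | m≤n⇒∣m-n∣≡n∸m c≤n =
  m≢n⇒1≤∣m-n∣ (a≢c ∘ ∸-cancelˡ-≡ a≤n c≤n)

suc-n≤sumTo-distGap : ∀ {a c n} → a ≤ n → c ≤ n → a ≢ c → suc n ≤ sumTo (suc n) (distGap a c)
suc-n≤sumTo-distGap {a} {c} a≤n c≤n a≢c =
  pairs≥2⇒suc-n≤sumTo _ {distGap a c} (λ i → distGap-adjacent i a≢c) (distGap-last a≤n c≤n a≢c)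

2+m≤n⇒2≤∣m-n∣ : ∀ {m n} → 2 + m ≤ n → 2 ≤ ∣ m - n ∣
2+m≤n⇒2≤∣m-n∣ {m} {n} 2+m≤n =
  +-cancelˡ-≤ m 2 _ (≤-trans (≤-reflexive (+-comm m 2)) (≤-trans 2+m≤n (m≤n+∣n-m∣ n m)))

-- As integers, a + (n ∸ c) − (c + (n ∸ a)) = 2 (a − c).
2≤∣a+[n∸c]-c+[n∸a]∣ : ∀ {a c n} → a ≤ n → c ≤ n → a ≢ c → 2 ≤ ∣ a + (n ∸ c) - c + (n ∸ a) ∣
2≤∣a+[n∸c]-c+[n∸a]∣ {zero}  {zero}          _         _         a≢c = ⊥-elim (a≢c refl)
2≤∣a+[n∸c]-c+[n∸a]∣ {zero}  {suc c} {suc n} _         _         _   =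
  2+m≤n⇒2≤∣m-n∣ (2+[n∸c]≤[1+c]+[1+n] n c)
  where
  2+[n∸c]≤[1+c]+[1+n] : ∀ n c → 2 + (n ∸ c) ≤ suc c + suc n
  2+[n∸c]≤[1+c]+[1+n] n c = s≤s (≤-trans (s≤s (m∸n≤m n c)) (m≤n+m (suc n) c))
2≤∣a+[n∸c]-c+[n∸a]∣ {suc a} {zero}  {suc n} a≤n       c≤n       a≢c =
  subst (2 ≤_) (∣-∣-comm (n ∸ a) (suc a + suc n)) (2≤∣a+[n∸c]-c+[n∸a]∣ c≤n a≤n (a≢c ∘ sym))
2≤∣a+[n∸c]-c+[n∸a]∣ {suc a} {suc c} {suc n} (s≤s a≤n) (s≤s c≤n) a≢c =
  2≤∣a+[n∸c]-c+[n∸a]∣ a≤n c≤n (a≢c ∘ cong suc)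

endpoints-separate : ∀ {a c n} β δ → a ≤ n → c ≤ n → a ≢ c →
  2 ≤ ∣ ∣ a - 0 ∣ + β - ∣ c - 0 ∣ + δ ∣ + ∣ ∣ a - n ∣ + β - ∣ c - n ∣ + δ ∣
endpoints-separate {a} {c} {n} β δ a≤n c≤n a≢c
  rewrite ∣-∣-identityʳ a | ∣-∣-identityʳ c | m≤n⇒∣m-n∣≡n∸m a≤n | m≤n⇒∣m-n∣≡n∸m c≤n = begin
    2                                                 ≤⟨ 2≤∣a+[n∸c]-c+[n∸a]∣ a≤n c≤n a≢c ⟩
    ∣ a + (n ∸ c) - c + (n ∸ a) ∣                     ≡⟨ cancel-β+δ ⟨
    ∣ (a + β) + (n ∸ c + δ) - (c + δ) + (n ∸ a + β) ∣ ≤⟨ ∣x+w-y+z∣≤∣x-y∣+∣z-w∣ (a + β) (c + δ) _ _ ⟩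
    ∣ a + β - c + δ ∣ + ∣ n ∸ a + β - n ∸ c + δ ∣     ∎
  where
  open ≤-Reasoning
  regroup : ∀ x β u δ → (x + β) + (u + δ) ≡ (β + δ) + (x + u)
  regroup = solve-∀
  cancel-β+δ : ∣ (a + β) + (n ∸ c + δ) - (c + δ) + (n ∸ a + β) ∣ ≡ ∣ a + (n ∸ c) - c + (n ∸ a) ∣
  cancel-β+δ = trans
    (cong₂ ∣_-_∣ (regroup a β (n ∸ c) δ)
                 (trans (regroup c δ (n ∸ a) β) (cong (_+ (c + (n ∸ a))) (+-comm δ β))))
    (∣m+n-m+o∣≡∣n-o∣ (β + δ) _ _)

endpoints-separateʳ : ∀ {a c n} β δ → a ≤ n → c ≤ n → a ≢ c →
  2 ≤ ∣ β + ∣ a - 0 ∣ - δ + ∣ c - 0 ∣ ∣ + ∣ β + ∣ a - n ∣ - δ + ∣ c - n ∣ ∣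
endpoints-separateʳ {a} {c} {n} β δ a≤n c≤n a≢c =
  subst (2 ≤_) (cong₂ _+_ (swap ∣ a - 0 ∣ ∣ c - 0 ∣) (swap ∣ a - n ∣ ∣ c - n ∣))
    (endpoints-separate β δ a≤n c≤n a≢c)
  where
  swap : ∀ x y → ∣ x + β - y + δ ∣ ≡ ∣ β + x - δ + y ∣
  swap x y = cong₂ ∣_-_∣ (+-comm x β) (+-comm y δ)

module _ {G : Graph} where

  _++ʷ_ : ∀ {u w v m n} → Walk G u w m → Walk G w v n → Walk G u v (m + n)
  here       ++ʷ q = q
  step u~w p ++ʷ q = step u~w (p ++ʷ q)

  snocʷ : ∀ {u w v n} → Walk G u w n → Adj G w v → Walk G u v (suc n)
  snocʷ here         w~v = step w~v here
  snocʷ (step u~x p) w~v = step u~x (snocʷ p w~v)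

  reverseʷ : (∀ {x y} → Adj G x y → Adj G y x) → ∀ {u v n} → Walk G u v n → Walk G v u n
  reverseʷ sym-adj here         = here
  reverseʷ sym-adj (step u~w p) = snocʷ (reverseʷ sym-adj p) (sym-adj u~w)

  mapʷ : ∀ {H : Graph} (f : V G → V H) → (∀ {x y} → Adj G x y → Adj H (f x) (f y)) →
         ∀ {u v n} → Walk G u v n → Walk H (f u) (f v) n
  mapʷ f f-adj here         = here
  mapʷ f f-adj (step u~w p) = step (f-adj u~w) (mapʷ f f-adj p)

  1-Lipschitz⇒≤length : (ρ : V G → V G → ℕ) → (∀ u → ρ u u ≡ 0) →
                        (∀ {u w} v → Adj G u w → ρ u v ≤ suc (ρ w v)) →
                        ∀ {u v n} → Walk G u v n → ρ u v ≤ n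
  1-Lipschitz⇒≤length ρ ρ-refl ρ-step {u} here = ≤-reflexive (ρ-refl u)
  1-Lipschitz⇒≤length ρ ρ-refl ρ-step {v = v} (step u~w p) =
    ≤-trans (ρ-step v u~w) (s≤s (1-Lipschitz⇒≤length ρ ρ-refl ρ-step p))

Path : ℕ → Graph
Path n = record { V = Fin n ; Adj = λ x y → ∣ toℕ x - toℕ y ∣ ≡ 1 }

walkFromZero : ∀ {n} (k : Fin (suc n)) → Walk (Path (suc n)) fzero k (toℕ k)
walkFromZero         fzero    = here
walkFromZero {suc n} (fsuc k) = step refl (mapʷ fsuc id (walkFromZero k))

pathWalk : ∀ {n} (i k : Fin n) → Walk (Path n) i k ∣ toℕ i - toℕ k ∣
pathWalk         fzero    k        = walkFromZero k
pathWalk         (fsuc i) fzero    =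
  reverseʷ (λ {x} {y} x~y → trans (∣-∣-comm (toℕ y) (toℕ x)) x~y) (walkFromZero (fsuc i))
pathWalk {suc n} (fsuc i) (fsuc k) = mapʷ fsuc id (pathWalk i k)

toℕ² : ∀ {q r} → Fin q × Fin r → ℕ × ℕ
toℕ² x = toℕ (proj₁ x) , toℕ (proj₂ x)

toℕ²-injective : ∀ {q r} {x y : Fin q × Fin r} → toℕ² x ≡ toℕ² y → x ≡ y
toℕ²-injective eq = cong₂ _,_ (toℕ-injective (cong proj₁ eq)) (toℕ-injective (cong proj₂ eq))

manhattan : ℕ × ℕ → ℕ × ℕ → ℕ
manhattan x y = ∣ proj₁ x - proj₁ y ∣ + ∣ proj₂ x - proj₂ y ∣

gridWalk : ∀ {q r} (u v : Fin q × Fin r) → Walk (Grid q r) u v (manhattan (toℕ² u) (toℕ² v))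
gridWalk (i , j) (k , l) =
  mapʷ (_, j) (λ i~i' → inj₂ (refl , i~i')) (pathWalk i k) ++ʷ
  mapʷ (k ,_) (λ j~j' → inj₁ (refl , j~j')) (pathWalk j l)

manhattan-step : ∀ {q r} {u w : Fin q × Fin r} (v : Fin q × Fin r) → Adj (Grid q r) u w →
                 manhattan (toℕ² u) (toℕ² v) ≤ suc (manhattan (toℕ² w) (toℕ² v))
manhattan-step {u = i , j} {w = _ , j'} (k , l) (inj₁ (refl , j~j')) =
  ≤-trans (+-monoʳ-≤ ∣ toℕ i - toℕ k ∣ (∣m-n∣≡1⇒∣m-o∣≤1+∣n-o∣ (toℕ j) (toℕ j') (toℕ l) j~j'))
          (≤-reflexive (+-suc _ _))
manhattan-step {u = i , j} {w = i' , _} (k , l) (inj₂ (refl , i~i')) =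
  +-monoˡ-≤ ∣ toℕ j - toℕ l ∣ (∣m-n∣≡1⇒∣m-o∣≤1+∣n-o∣ (toℕ i) (toℕ i') (toℕ k) i~i')

grid-distance : ∀ {q r} {d : Fin q × Fin r → Fin q × Fin r → ℕ} → IsDistance (Grid q r) d →
                ∀ u v → d u v ≡ manhattan (toℕ² u) (toℕ² v)
grid-distance isDistance u v = ≤-antisym
  (proj₂ (isDistance u v) _ (gridWalk u v))
  (1-Lipschitz⇒≤length (λ x y → manhattan (toℕ² x) (toℕ² y)) manhattan-refl manhattan-step
    (proj₁ (isDistance u v)))
  where
  manhattan-refl : ∀ x → manhattan (toℕ² x) (toℕ² x) ≡ 0
  manhattan-refl (i , j) = cong₂ _+_ (∣n-n∣≡0 (toℕ i)) (∣n-n∣≡0 (toℕ j))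

ΔGrid : ℕ → ℕ → ℕ × ℕ → ℕ × ℕ → ℕ
ΔGrid q r x y = sumTo q λ i → sumTo r λ j → ∣ manhattan x (i , j) - manhattan y (i , j) ∣

-- The boundary of the (2 + q') × (2 + r') grid: its first and last rows, and the
-- two end vertices of each of the q' inner rows.
perimeter : ℕ → ℕ → ℕ
perimeter q' r' = q' * 2 + (2 + r') * 2

perimeter≤area : ∀ q' r' → perimeter q' r' ≤ (2 + q') * (2 + r')
perimeter≤area q' r' = subst (perimeter q' r' ≤_) (sym (area≡perimeter+ q' r')) (m≤m+n _ _)
  where
  area≡perimeter+ : ∀ q' r' → (2 + q') * (2 + r') ≡ (q' * 2 + (2 + r') * 2) + q' * r'
  area≡perimeter+ = solve-∀

perimeter≤ΔGrid-sameRow : ∀ {q' r'} a {b e} → b ≤ suc r' → e ≤ suc r' → b ≢ e →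
                          perimeter q' r' ≤ ΔGrid (2 + q') (2 + r') (a , b) (a , e)
perimeter≤ΔGrid-sameRow {q'} {r'} a {b} {e} b≤ e≤ b≢e =
  ≤-trans (perimeter≤area q' r') (n*c≤sumTo (2 + q') rowBound)
  where
  rowBound : ∀ i → 2 + r' ≤ sumTo (2 + r') (λ j → ∣ ∣ a - i ∣ + ∣ b - j ∣ - ∣ a - i ∣ + ∣ e - j ∣ ∣)
  rowBound i = subst (2 + r' ≤_)
    (sumTo-cong (2 + r') (λ j → sym (∣m+n-m+o∣≡∣n-o∣ ∣ a - i ∣ ∣ b - j ∣ ∣ e - j ∣)))
    (suc-n≤sumTo-distGap b≤ e≤ b≢e)

perimeter≤ΔGrid-sameColumn : ∀ {q' r' a c} b → a ≤ suc q' → c ≤ suc q' → a ≢ c →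
                             perimeter q' r' ≤ ΔGrid (2 + q') (2 + r') (a , b) (c , b)
perimeter≤ΔGrid-sameColumn {q'} {r'} {a} {c} b a≤ c≤ a≢c = begin
  perimeter q' r'                                 ≤⟨ perimeter≤area q' r' ⟩
  (2 + q') * (2 + r')                             ≡⟨ *-comm (2 + q') (2 + r') ⟩
  (2 + r') * (2 + q')                             ≤⟨ *-monoʳ-≤ (2 + r') (suc-n≤sumTo-distGap a≤ c≤ a≢c) ⟩
  (2 + r') * sumTo (2 + q') (distGap a c)         ≡⟨ sumTo-* (2 + q') (2 + r') (distGap a c) ⟨
  sumTo (2 + q') (λ i → (2 + r') * distGap a c i) ≡⟨ sumTo-cong (2 + q') rowValue ⟨
  ΔGrid (2 + q') (2 + r') (a , b) (c , b)         ∎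
  where
  open ≤-Reasoning
  rowValue : ∀ i → sumTo (2 + r') (λ j → ∣ ∣ a - i ∣ + ∣ b - j ∣ - ∣ c - i ∣ + ∣ b - j ∣ ∣)
                   ≡ (2 + r') * distGap a c i
  rowValue i = trans (sumTo-cong (2 + r') (λ j → ∣m+o-n+o∣≡∣m-n∣ ∣ a - i ∣ ∣ c - i ∣ ∣ b - j ∣))
                     (sumTo-const (2 + r') (distGap a c i))

perimeter≤ΔGrid-generic : ∀ {q' r' a b c e} → a ≤ suc q' → c ≤ suc q' → b ≤ suc r' → e ≤ suc r' →
                          a ≢ c → b ≢ e → perimeter q' r' ≤ ΔGrid (2 + q') (2 + r') (a , b) (c , e)
perimeter≤ΔGrid-generic {q'} {r'} {a} {b} {c} {e} a≤ c≤ b≤ e≤ a≢c b≢e = begin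
  perimeter q' r'                               ≡⟨ +-comm (q' * 2) _ ⟩
  (2 + r') * 2 + q' * 2                         ≤⟨ +-mono-≤ outerRows innerRows ⟩
  (row 0 + row (suc q')) + sumTo q' (row ∘ suc) ≡⟨ sumTo-firstLast q' row ⟨
  ΔGrid (2 + q') (2 + r') (a , b) (c , e)       ∎
  where
  open ≤-Reasoning
  entry : ℕ → ℕ → ℕ
  entry i j = ∣ manhattan (a , b) (i , j) - manhattan (c , e) (i , j) ∣
  row : ℕ → ℕ
  row i = sumTo (2 + r') (entry i)
  outerRows : (2 + r') * 2 ≤ row 0 + row (suc q')
  outerRows = subst ((2 + r') * 2 ≤_) (sumTo-+ (2 + r') (entry 0) (entry (suc q')))
    (n*c≤sumTo (2 + r') λ j → endpoints-separate ∣ b - j ∣ ∣ e - j ∣ a≤ c≤ a≢c)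
  innerRows : q' * 2 ≤ sumTo q' (row ∘ suc)
  innerRows = n*c≤sumTo q' λ i → ≤-trans
    (endpoints-separateʳ ∣ a - suc i ∣ ∣ c - suc i ∣ b≤ e≤ b≢e)
    (firstLast≤sumTo r' (entry (suc i)))

perimeter≤ΔGrid : ∀ {q' r' a b c e} → a < 2 + q' → c < 2 + q' → b < 2 + r' → e < 2 + r' →
                  (a , b) ≢ (c , e) → perimeter q' r' ≤ ΔGrid (2 + q') (2 + r') (a , b) (c , e)
perimeter≤ΔGrid {q'} {r'} {a} {b} {c} {e} (s≤s a≤) (s≤s c≤) (s≤s b≤) (s≤s e≤) x≢y
  with a ≟ c | b ≟ e
... | yes refl | yes refl = ⊥-elim (x≢y refl)
... | yes refl | no b≢e   = perimeter≤ΔGrid-sameRow {q'} a b≤ e≤ b≢e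
... | no a≢c   | yes refl = perimeter≤ΔGrid-sameColumn {r' = r'} b a≤ c≤ a≢c
... | no a≢c   | no b≢e   = perimeter≤ΔGrid-generic a≤ c≤ b≤ e≤ a≢c b≢e

-- (1,0) and (0,1) differ by 2 exactly at the vertices (0,j), j ≥ 1, and (i,0), i ≥ 1.
ΔGrid-cornerNeighbours : ∀ q' r' → ΔGrid (2 + q') (2 + r') (1 , 0) (0 , 1) ≡ perimeter q' r'
ΔGrid-cornerNeighbours q' r' = begin
  row 0 + sumTo (suc q') (row ∘ suc)     ≡⟨ cong₂ _+_ firstRow (sumTo-cong (suc q') otherRow) ⟩
  suc r' * 2 + sumTo (suc q') (λ _ → 2)  ≡⟨ cong (suc r' * 2 +_) (sumTo-const (suc q') 2) ⟩
  suc r' * 2 + suc q' * 2                ≡⟨ rearrange q' r' ⟩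
  perimeter q' r'                        ∎
  where
  open ≡-Reasoning
  row : ℕ → ℕ
  row i = sumTo (2 + r') λ j → ∣ manhattan (1 , 0) (i , j) - manhattan (0 , 1) (i , j) ∣
  firstRow : row 0 ≡ suc r' * 2
  firstRow = trans (sumTo-cong (suc r') ∣2+n-n∣≡2) (sumTo-const (suc r') 2)
  firstColumn : ∀ i → ∣ i + 0 - suc (i + 1) ∣ ≡ 2
  firstColumn zero    = refl
  firstColumn (suc i) = firstColumn i
  interior : ∀ i j → ∣ i + suc j - suc (i + j) ∣ ≡ 0
  interior zero    j = ∣n-n∣≡0 j
  interior (suc i) j = interior i j
  otherRow : ∀ i → row (suc i) ≡ 2
  otherRow i = cong₂ _+_ (firstColumn i)
    (trans (sumTo-cong (suc r') (interior i)) (trans (sumTo-const (suc r') 0) (*-zeroʳ (suc r'))))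
  rearrange : ∀ q' r' → suc r' * 2 + suc q' * 2 ≡ q' * 2 + (2 + r') * 2
  rearrange = solve-∀

allVertices : ∀ {q r} → GridSubset q r
allVertices _ _ = true

ΔS-mono-allVertices : ∀ {q r} (d : Fin q × Fin r → Fin q × Fin r → ℕ) (S : GridSubset q r) x y →
                      ΔS d S x y ≤ ΔS d allVertices x y
ΔS-mono-allVertices {q} {r} d S x y =
  sumFin-mono-≤ q λ i → sumFin-mono-≤ r λ j → if≤then (S i j)
  where
  if≤then : ∀ {n} b → (if b then n else 0) ≤ n
  if≤then true  = ≤-refl
  if≤then false = z≤n

ΔS-allVertices : ∀ {q r} {d : Fin q × Fin r → Fin q × Fin r → ℕ} → IsDistance (Grid q r) d →
                 ∀ x y → ΔS d allVertices x y ≡ ΔGrid q r (toℕ² x) (toℕ² y)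
ΔS-allVertices {q} {r} isDistance x y = sumFin≡sumTo q λ i → sumFin≡sumTo r λ j →
  cong₂ ∣_-_∣ (grid-distance isDistance x (i , j)) (grid-distance isDistance y (i , j))

perimeter-formula : ∀ q' r' → 2 * (2 + q') + 2 * (2 + r') ∸ 4 ≡ perimeter q' r'
perimeter-formula q' r' = trans (cong (_∸ 4) (double q' r')) (m+n∸n≡m (perimeter q' r') 4)
  where
  double : ∀ q' r' → 2 * (2 + q') + 2 * (2 + r') ≡ (q' * 2 + (2 + r') * 2) + 4
  double = solve-∀

theorem3p2 : (q r : ℕ) → 2 ≤ q → 2 ≤ r →
    (d : Fin q × Fin r → Fin q × Fin r → ℕ) → IsDistance (Grid q r) d →
    KappaIs d (2 * q + 2 * r ∸ 4)
theorem3p2 (suc (suc q')) (suc (suc r')) (s≤s (s≤s z≤n)) (s≤s (s≤s z≤n)) d isDistance =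
  subst (KappaIs d) (sym (perimeter-formula q' r')) (1≤perimeter , (allVertices , resolves) , maximal)
  where
  1≤perimeter : 1 ≤ perimeter q' r'
  1≤perimeter = ≤-trans (s≤s z≤n) (m≤n+m ((2 + r') * 2) (q' * 2))
  resolves : WeakResolving d (perimeter q' r') allVertices
  resolves x@(a , b) y@(c , e) x≢y =
    subst (perimeter q' r' ≤_) (sym (ΔS-allVertices isDistance x y))
      (perimeter≤ΔGrid (toℕ<n a) (toℕ<n c) (toℕ<n b) (toℕ<n e) (x≢y ∘ toℕ²-injective))
  maximal : ∀ k S → 1 ≤ k → WeakResolving d k S → k ≤ perimeter q' r'
  maximal k S _ S-resolves = begin
    k                                       ≤⟨ S-resolves x y (λ ()) ⟩
    ΔS d S x y                              ≤⟨ ΔS-mono-allVertices d S x y ⟩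
    ΔS d allVertices x y                    ≡⟨ ΔS-allVertices isDistance x y ⟩
    ΔGrid (2 + q') (2 + r') (1 , 0) (0 , 1) ≡⟨ ΔGrid-cornerNeighbours q' r' ⟩
    perimeter q' r'                         ∎
    where
    open ≤-Reasoning
    x y : Fin (2 + q') × Fin (2 + r')
    x = fsuc fzero , fzero
    y = fzero , fsuc fzero
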